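{- Let $k\ge 6$ and let $G$ be a non-complete double-critical $k$-chromatic graph. Then no minimal separating set $S$ of $G$ can be partitioned into two disjoint sets $A$ and $B$ such that the induced graph $G[A]$ has no edges and the induced graph $G[B]$ is complete.
   Context: All graphs are finite and simple. A graph $G$ is (vertex-)critical if $\chi(G-v)<\chi(G)$ for every vertex $v$. A critical graph $G$ is double-critical if $\chi(G-x-y)\le \chi(G)-2$ for every edge $xy\in E(G)$ (here $G-x-y$ denotes deletion of both end-vertices). A separating set is a set $S\subseteq V(G)$ with $G-S$ disconnected; it is minimal if no proper subset is separating. -}

module Defs where

open import Data.Nat using (ℕ; _∸_)
open import Data.Fin using (Fin)
open import Data.Fin.Subset using (Subset; _∈_; _∉_; _⊂_; ⊤; _∪_; _∩_; ∁; Empty; ⁅_⁆)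
open import Data.Product using (Σ; _×_; ∃; ∃-syntax)
open import Relation.Binary.PropositionalEquality using (_≡_; _≢_)
open import Relation.Nullary using (¬_)

record Graph (n : ℕ) : Set₁ where
  field
    Adj   : Fin n → Fin n → Set
    sym   : ∀ {x y} → Adj x y → Adj y x
    irrefl : ∀ {x} → ¬ Adj x x
open Graph public

module _ {n : ℕ} (G : Graph n) where

  ProperColouring : Subset n → ℕ → Set
  ProperColouring U c =
    Σ (Fin n → Fin c) λ f →
      ∀ x y → x ∈ U → y ∈ U → Adj G x y → f x ≢ f y

  Colourable : Subset n → ℕ → Set
  Colourable U c = ProperColouring U c

  ChromaticNumber : Subset n → ℕ → Set
  ChromaticNumber U k = Colourable U k × ¬ Colourable U (k ∸ 1)

  KChromatic : ℕ → Set
  KChromatic k = ChromaticNumber ⊤ k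

  remove : Fin n → Subset n → Subset n
  remove v U = U ∩ ∁ ⁅ v ⁆

  Critical : ℕ → Set
  Critical k = ∀ v → Colourable (remove v ⊤) (k ∸ 1)

  DoubleCritical : ℕ → Set
  DoubleCritical k =
    Critical k × (∀ x y → Adj G x y → Colourable (remove y (remove x ⊤)) (k ∸ 2))

  Complete : Set
  Complete = ∀ x y → x ≢ y → Adj G x y

  data Reach (U : Subset n) : Fin n → Fin n → Set where
    here : ∀ {x} → Reach U x x
    step : ∀ {x y z} → Adj G x y → y ∈ U → Reach U y z → Reach U x z

  Disconnected : Subset n → Set
  Disconnected U = ∃[ u ] ∃[ v ] (u ∈ U × v ∈ U × ¬ Reach U u v)

  Separating : Subset n → Set
  Separating S = Disconnected (∁ S)

  MinimalSeparating : Subset n → Set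
  MinimalSeparating S = Separating S × (∀ T → T ⊂ S → ¬ Separating T)

  Independent : Subset n → Set
  Independent A = ∀ x y → x ∈ A → y ∈ A → ¬ Adj G x y

  Clique : Subset n → Set
  Clique B = ∀ x y → x ∈ B → y ∈ B → x ≢ y → Adj G x y

  PartitionOf : Subset n → Subset n → Subset n → Set
  PartitionOf S A B = (A ∪ B ≡ S) × Empty (A ∩ B)

-- We build a (k−1)-colouring of G, a contradiction.
--
-- Let u, v lie in different components of G − S and let X be S together
-- with the component of u.  No vertex has its whole neighbourhood inside the
-- clique B (such a vertex would force G to be complete), so u and v have
-- neighbours y₂, y₁ outside B.  By double-criticality G − v − y₁ and
-- G − u − y₂ have (k−2)-colourings g₁, g₂; g₁ colours X ∖ A and g₂ colours
-- the rest of G, both colour B.  Every edge leaving X starts in B, and after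
-- permuting the colours of g₂ to agree with g₁ on the clique B the two
-- colourings glue to a (k−2)-colouring of G − A; the independent set A takes
-- one fresh colour.  Since the goal is a negation we may reason classically,
-- assuming adjacency and reachability in G − S decidable.
--
-- The argument uses only k ≥ 2 and that S is separating (not minimality).
module Submission where

open import Defs hiding (sym)
open import Data.Nat using (ℕ; _≤_; suc; s≤s)
open import Data.Nat.Properties using (n<1+n)
open import Data.Fin using (Fin; zero; suc; inject₁; fromℕ; _≟_)
open import Data.Fin.Properties
  using (any?; pigeonhole; inject₁-injective; fromℕ≢inject₁; <⇒≢; sequence)
open import Data.Fin.Permutation using (Permutation′; _⟨$⟩ʳ_; _∘ₚ_; transpose; id)
import Data.Fin.Permutation.Components as PC
open import Data.Fin.Subset using (Subset; _∈_; _∉_; ⊤; _∪_; ∁)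
open import Data.Fin.Subset.Properties
  using (_∈?_; ∈⊤; x≢y⇒x∉⁅y⁆; x∈∁p⇒x∉p; x∉p⇒x∈∁p; x∈p∩q⁺; x∈p∪q⁻; x∈p∪q⁺)
open import Data.Product using (_×_; _,_; proj₁; proj₂; Σ)
open import Data.Sum using (_⊎_; inj₁; inj₂)
open import Data.List using (List; []; _∷_; allFin)
open import Data.List.Membership.Propositional using () renaming (_∈_ to _∈ˡ_)
open import Data.List.Membership.Propositional.Properties using (∈-allFin)
open import Data.List.Relation.Unary.Any using (here; there)
open import Data.Empty using (⊥; ⊥-elim)
open import Effect.Monad using (RawMonad)
open import Function.Bundles using (Injection)
open import Function.Properties.Inverse using (↔⇒↣)
open import Relation.Nullary using (¬_; Dec; yes; no; ¬?)
open import Relation.Nullary.Decidable using (_×-dec_; ¬¬-excluded-middle)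
open import Relation.Nullary.Negation using (¬¬-Monad)
open import Relation.Binary.PropositionalEquality using (_≡_; _≢_; refl; sym; trans; cong; subst)

-- Classical reasoning towards ⊥: every family of propositions indexed by a
-- finite set may be assumed decidable.
¬¬-decidable : ∀ {n} {P : Fin n → Set} → ¬ ¬ (∀ i → Dec (P i))
¬¬-decidable = sequence (RawMonad.rawApplicative ¬¬-Monad) (λ _ → ¬¬-excluded-middle)

¬¬-decidable₂ : ∀ {n} {R : Fin n → Fin n → Set} → ¬ ¬ (∀ i j → Dec (R i j))
¬¬-decidable₂ = sequence (RawMonad.rawApplicative ¬¬-Monad) (λ _ → ¬¬-decidable)

transpose-hits : ∀ {m} (a c : Fin m) → PC.transpose a c a ≡ c
transpose-hits a c with a ≟ a
... | yes _ = refl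
... | no a≢a = ⊥-elim (a≢a refl)

transpose-fixes : ∀ {m} (a c x : Fin m) → x ≢ a → x ≢ c → PC.transpose a c x ≡ x
transpose-fixes a c x x≢a x≢c with x ≟ a
... | yes x≡a = ⊥-elim (x≢a x≡a)
... | no _ with x ≟ c
... | yes x≡c = ⊥-elim (x≢c x≡c)
... | no _ = refl

permutation-injective : ∀ {m} (π : Permutation′ m) {x y} → π ⟨$⟩ʳ x ≡ π ⟨$⟩ʳ y → x ≡ y
permutation-injective π = Injection.injective (↔⇒↣ π)

DistinctOn : ∀ {n m} → Subset n → (Fin n → Fin m) → Set
DistinctOn B g = ∀ b b' → b ∈ B → b' ∈ B → b ≢ b' → g b ≢ g b'

module Align {n m : ℕ} (B : Subset n) (g₁ g₂ : Fin n → Fin m)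
  (g₁-distinct : DistinctOn B g₁) (g₂-distinct : DistinctOn B g₂) where

  AlignedOn : List (Fin n) → Permutation′ m → Set
  AlignedOn L π = ∀ b → b ∈ˡ L → b ∈ B → π ⟨$⟩ʳ g₂ b ≡ g₁ b

  align-list : ∀ L → Σ (Permutation′ m) (AlignedOn L)
  align-list [] = id , λ _ ()
  align-list (b ∷ L) with align-list L | b ∈? B
  ... | π , aligned | no b∉B = π , λ where
        _ (here refl) b∈B → ⊥-elim (b∉B b∈B)
        b' (there b'∈L) b'∈B → aligned b' b'∈L b'∈B
  ... | π , aligned | yes b∈B = π ∘ₚ transpose (π ⟨$⟩ʳ g₂ b) (g₁ b) , aligned′
    where
      aligned′ : AlignedOn (b ∷ L) (π ∘ₚ transpose (π ⟨$⟩ʳ g₂ b) (g₁ b))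
      aligned′ _ (here refl) _ = transpose-hits (π ⟨$⟩ʳ g₂ b) (g₁ b)
      aligned′ b' (there b'∈L) b'∈B with b' ≟ b
      ... | yes refl = transpose-hits (π ⟨$⟩ʳ g₂ b) (g₁ b)
      -- b' keeps its colour: it differs from both transposed colours
      ... | no b'≢b =
        trans (cong (PC.transpose _ _) (aligned b' b'∈L b'∈B))
              (transpose-fixes _ _ (g₁ b')
                 (λ e → g₂-distinct b' b b'∈B b∈B b'≢b
                          (permutation-injective π (trans (aligned b' b'∈L b'∈B) e)))
                 (g₁-distinct b' b b'∈B b∈B b'≢b))

  align : Σ (Permutation′ m) λ π → ∀ b → b ∈ B → π ⟨$⟩ʳ g₂ b ≡ g₁ b
  align with align-list (allFin n)
  ... | π , aligned = π , λ b → aligned b (∈-allFin b)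

module _ {n : ℕ} (G : Graph n) where

  ∈-remove : ∀ {z v : Fin n} {U : Subset n} → z ≢ v → z ∈ U → z ∈ remove G v U
  ∈-remove z≢v z∈U = x∈p∩q⁺ (z∈U , x∉p⇒x∈∁p (x≢y⇒x∉⁅y⁆ z≢v))

  ∈-remove₂ : ∀ {z x y : Fin n} → z ≢ x → z ≢ y → z ∈ remove G y (remove G x ⊤)
  ∈-remove₂ z≢x z≢y = ∈-remove z≢y (∈-remove z≢x ∈⊤)

  reach-snoc : ∀ {U x y z} → Reach G U x y → Adj G y z → z ∈ U → Reach G U x z
  reach-snoc here y~z z∈U = step y~z z∈U here
  reach-snoc (step x~x' x'∈U r) y~z z∈U = step x~x' x'∈U (reach-snoc r y~z z∈U)

  proper-distinct-on-clique : ∀ {U B c} → Clique G B → (∀ z → z ∈ B → z ∈ U) →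
    (col : ProperColouring G U c) → DistinctOn B (proj₁ col)
  proper-distinct-on-clique clique B⊆U (_ , proper) b b' b∈B b'∈B b≢b' =
    proper b b' (B⊆U b b∈B) (B⊆U b' b'∈B) (clique b b' b∈B b'∈B b≢b')

  clique-bound : ∀ {U c} → ProperColouring G U c → (e : Fin (suc c) → Fin n) →
    (∀ i → e i ∈ U) → (∀ i j → i ≢ j → Adj G (e i) (e j)) → ⊥
  clique-bound {c = c} (f , proper) e e∈U e-clique
    with pigeonhole (n<1+n c) (λ i → f (e i))
  ... | i , j , i<j , same = proper (e i) (e j) (e∈U i) (e∈U j) (e-clique i j (<⇒≢ i<j)) same

  extend-at-vertex : ∀ {c} (w : Fin n) ((h , _) : ProperColouring G (remove G w ⊤) c) →
    (col : Fin c) → (∀ x → Adj G w x → h x ≢ col) → Colourable G ⊤ c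
  extend-at-vertex w (h , proper) col col-free = h′ , proper′
    where
      h′ : Fin n → Fin _
      h′ z with z ≟ w
      ... | yes _ = col
      ... | no _ = h z
      proper′ : ∀ x y → x ∈ ⊤ → y ∈ ⊤ → Adj G x y → h′ x ≢ h′ y
      proper′ x y _ _ x~y with x ≟ w | y ≟ w
      ... | yes refl | yes refl = ⊥-elim (Graph.irrefl G x~y)
      ... | yes refl | no _ = λ e → col-free y x~y (sym e)
      ... | no _ | yes refl = col-free x (Graph.sym G x~y)
      ... | no x≢w | no y≢w = proper x y (∈-remove x≢w ∈⊤) (∈-remove y≢w ∈⊤) x~y

  module SimplicialVertex {c : ℕ} (adj? : ∀ x y → Dec (Adj G x y))
    (not-colourable : ¬ Colourable G ⊤ (suc c))
    (critical : ∀ w → Colourable G (remove G w ⊤) (suc c))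
    (w : Fin n) (N-clique : ∀ x y → Adj G w x → Adj G w y → x ≢ y → Adj G x y) where

    h : Fin n → Fin (suc c)
    h = proj₁ (critical w)

    -- Every colour of the colouring h of G − w occurs on N(w), since
    -- otherwise h would extend to G.
    colour-witness : ∀ col → Σ (Fin n) λ x → Adj G w x × h x ≡ col
    colour-witness col with any? (λ x → adj? w x ×-dec (h x ≟ col))
    ... | yes found = found
    ... | no none = ⊥-elim (not-colourable
          (extend-at-vertex w (critical w) col (λ x w~x e → none (x , w~x , e))))

    big-clique : Fin (suc (suc c)) → Fin n
    big-clique zero = w
    big-clique (suc col) = proj₁ (colour-witness col)

    big-clique-adj : ∀ i j → i ≢ j → Adj G (big-clique i) (big-clique j)
    big-clique-adj zero zero i≢j = ⊥-elim (i≢j refl)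
    big-clique-adj zero (suc d) _ = proj₁ (proj₂ (colour-witness d))
    big-clique-adj (suc c) zero _ = Graph.sym G (proj₁ (proj₂ (colour-witness c)))
    big-clique-adj (suc c) (suc d) i≢j =
      N-clique _ _ (proj₁ (proj₂ (colour-witness c))) (proj₁ (proj₂ (colour-witness d)))
        (λ same → i≢j (cong suc (trans (sym (proj₂ (proj₂ (colour-witness c))))
                                   (trans (cong h same) (proj₂ (proj₂ (colour-witness d)))))))

    -- w dominates G: deleting a vertex z off N[w] would leave the (c+2)-clique
    -- intact in the (c+1)-colourable graph G − z.
    dominating : ∀ z → z ≡ w ⊎ Adj G w z
    dominating z with z ≟ w | adj? w z
    ... | yes z≡w | _ = inj₁ z≡w
    ... | no _ | yes w~z = inj₂ w~z
    ... | no z≢w | no w≁z = ⊥-elim (clique-bound (critical z) big-clique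
          (λ i → ∈-remove (avoids-z i) ∈⊤) big-clique-adj)
      where
        avoids-z : ∀ i → big-clique i ≢ z
        avoids-z zero w≡z = z≢w (sym w≡z)
        avoids-z (suc col) x≡z = w≁z (subst (Adj G w) x≡z (proj₁ (proj₂ (colour-witness col))))

    complete : Complete G
    complete x y x≢y with dominating x | dominating y
    ... | inj₁ refl | inj₁ refl = ⊥-elim (x≢y refl)
    ... | inj₁ refl | inj₂ w~y = w~y
    ... | inj₂ w~x | inj₁ refl = Graph.sym G w~x
    ... | inj₂ w~x | inj₂ w~y = N-clique x y w~x w~y x≢y

  neighbour-outside-clique : ∀ {c} → (∀ x y → Dec (Adj G x y)) →
    ¬ Colourable G ⊤ (suc c) → (∀ w → Colourable G (remove G w ⊤) (suc c)) →
    ¬ Complete G → ∀ {B} → Clique G B → ∀ w → Σ (Fin n) λ y → Adj G w y × y ∉ B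
  neighbour-outside-clique adj? not-colourable critical not-complete {B} clique w
    with any? (λ y → adj? w y ×-dec ¬? (y ∈? B))
  ... | yes found = found
  ... | no none = ⊥-elim (not-complete (SimplicialVertex.complete adj? not-colourable critical w
          (λ x y w~x w~y → clique x y (in-B w~x) (in-B w~y))))
    where
      in-B : ∀ {y} → Adj G w y → y ∈ B
      in-B {y} w~y with y ∈? B
      ... | yes y∈B = y∈B
      ... | no y∉B = ⊥-elim (none (y , w~y , y∉B))

  extend-by-independent-set : ∀ {m} (A : Subset n) → Independent G A →
    (f : Fin n → Fin m) → (∀ x y → x ∉ A → y ∉ A → Adj G x y → f x ≢ f y) →
    Colourable G ⊤ (suc m)
  extend-by-independent-set {m} A independent f proper = f′ , proper′
    where
      f′ : Fin n → Fin (suc m)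
      f′ z with z ∈? A
      ... | yes _ = fromℕ m
      ... | no _ = inject₁ (f z)
      proper′ : ∀ x y → x ∈ ⊤ → y ∈ ⊤ → Adj G x y → f′ x ≢ f′ y
      proper′ x y _ _ x~y with x ∈? A | y ∈? A
      ... | yes x∈A | yes y∈A = ⊥-elim (independent x y x∈A y∈A x~y)
      ... | yes _ | no _ = fromℕ≢inject₁
      ... | no _ | yes _ = λ e → fromℕ≢inject₁ (sym e)
      ... | no x∉A | no y∉A = λ e → proper x y x∉A y∉A x~y (inject₁-injective e)

  -- A colouring f₁
  -- of X ∩ W and a colouring f₂ of the complement of X, both also colouring
  -- B, combine into a colouring of W: on B the colours of f₂ are permuted to
  -- agree with f₁.
  module Gluing {m : ℕ} {B : Subset n} (clique : Clique G B)
    (W X : Fin n → Set) (X? : ∀ z → Dec (X z))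
    (crossing : ∀ x y → X x → ¬ X y → W x → Adj G x y → x ∈ B)
    {U₁ U₂ : Subset n} (col₁ : ProperColouring G U₁ m) (col₂ : ProperColouring G U₂ m)
    (X-in-U₁ : ∀ z → X z → W z → z ∈ U₁) (not-X-in-U₂ : ∀ z → ¬ X z → z ∈ U₂)
    (B-in-U₁ : ∀ z → z ∈ B → z ∈ U₁) (B-in-U₂ : ∀ z → z ∈ B → z ∈ U₂) where

    f₁ f₂ : Fin n → Fin m
    f₁ = proj₁ col₁
    f₂ = proj₁ col₂

    colour-alignment : Σ (Permutation′ m) λ π → ∀ b → b ∈ B → π ⟨$⟩ʳ f₂ b ≡ f₁ b
    colour-alignment = Align.align B f₁ f₂ (proper-distinct-on-clique clique B-in-U₁ col₁)
                                           (proper-distinct-on-clique clique B-in-U₂ col₂)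

    π : Permutation′ m
    π = proj₁ colour-alignment

    π-aligns : ∀ b → b ∈ B → π ⟨$⟩ʳ f₂ b ≡ f₁ b
    π-aligns = proj₂ colour-alignment

    glued : Fin n → Fin m
    glued z with X? z
    ... | yes _ = f₁ z
    ... | no _ = π ⟨$⟩ʳ f₂ z

    -- A crossing edge xy is coloured by f₂ at both ends, via x ∈ B.
    crossing-proper : ∀ x y → X x → ¬ X y → W x → Adj G x y → f₁ x ≢ π ⟨$⟩ʳ f₂ y
    crossing-proper x y x∈X y∉X x∈W x~y same =
      proj₂ col₂ x y (B-in-U₂ x x∈B) (not-X-in-U₂ y y∉X) x~y
        (permutation-injective π (trans (π-aligns x x∈B) same))
      where x∈B = crossing x y x∈X y∉X x∈W x~y

    glued-proper : ∀ x y → W x → W y → Adj G x y → glued x ≢ glued y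
    glued-proper x y x∈W y∈W x~y with X? x | X? y
    ... | yes x∈X | yes y∈X = proj₂ col₁ x y (X-in-U₁ x x∈X x∈W) (X-in-U₁ y y∈X y∈W) x~y
    ... | no x∉X | no y∉X = λ same →
          proj₂ col₂ x y (not-X-in-U₂ x x∉X) (not-X-in-U₂ y y∉X) x~y (permutation-injective π same)
    ... | yes x∈X | no y∉X = crossing-proper x y x∈X y∉X x∈W x~y
    ... | no x∉X | yes y∈X = λ same →
          crossing-proper y x y∈X x∉X y∈W (Graph.sym G x~y) (sym same)

  module USide {S A B : Subset n} (partition : A ∪ B ≡ S) (u : Fin n)
    (reach? : ∀ z → Dec (Reach G (∁ S) u z)) where

    USide : Fin n → Set
    USide z = z ∈ S ⊎ Reach G (∁ S) u z

    uside? : ∀ z → Dec (USide z)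
    uside? z with z ∈? S | reach? z
    ... | yes z∈S | _ = yes (inj₁ z∈S)
    ... | no _ | yes r = yes (inj₂ r)
    ... | no z∉S | no ¬r = no λ where
          (inj₁ z∈S) → z∉S z∈S
          (inj₂ r) → ¬r r

    A-or-B : ∀ {z} → z ∈ S → z ∈ A ⊎ z ∈ B
    A-or-B {z} z∈S = x∈p∪q⁻ A B (subst (z ∈_) (sym partition) z∈S)

    off-S-not-in-B : ∀ {z} → z ∈ ∁ S → z ∉ B
    off-S-not-in-B {z} z∉S z∈B = x∈∁p⇒x∉p z∉S (subst (z ∈_) partition (x∈p∪q⁺ (inj₂ z∈B)))

    leaving-edge-in-B : ∀ x y → USide x → ¬ USide y → x ∉ A → Adj G x y → x ∈ B
    leaving-edge-in-B x y (inj₁ x∈S) _ x∉A _ with A-or-B x∈S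
    ... | inj₁ x∈A = ⊥-elim (x∉A x∈A)
    ... | inj₂ x∈B = x∈B
    leaving-edge-in-B x y (inj₂ r) y-off _ x~y with y ∈? S
    ... | yes y∈S = ⊥-elim (y-off (inj₁ y∈S))
    ... | no y∉S = ⊥-elim (y-off (inj₂ (reach-snoc r x~y (x∉p⇒x∈∁p y∉S))))

    neighbour-of-u-on-side : ∀ {y} → Adj G u y → USide y
    neighbour-of-u-on-side {y} u~y with y ∈? S
    ... | yes y∈S = inj₁ y∈S
    ... | no y∉S = inj₂ (step u~y (x∉p⇒x∈∁p y∉S) here)

    neighbour-off-side : ∀ {v y} → ¬ USide v → Adj G v y → y ∉ B → y ∈ A ⊎ ¬ USide y
    neighbour-off-side {v} {y} v-off v~y y∉B with y ∈? S
    ... | yes y∈S with A-or-B y∈S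
    ...   | inj₁ y∈A = inj₁ y∈A
    ...   | inj₂ y∈B = ⊥-elim (y∉B y∈B)
    neighbour-off-side {v} {y} v-off v~y y∉B | no y∉S = inj₂ λ where
          (inj₁ y∈S) → y∉S y∈S
          (inj₂ r) → v-off (inj₂ (reach-snoc r (Graph.sym G v~y) v∉S))
      where v∉S = x∉p⇒x∈∁p (λ v∈S → v-off (inj₁ v∈S))

    uside-avoids : ∀ {z x} → USide z → z ∉ A → x ∈ A ⊎ ¬ USide x → z ≢ x
    uside-avoids _ z∉A (inj₁ x∈A) refl = z∉A x∈A
    uside-avoids z-on _ (inj₂ x-off) refl = x-off z-on

    off-side-avoids : ∀ {z x} → ¬ USide z → USide x → z ≢ x
    off-side-avoids z-off x-on refl = z-off x-on

split-separator-colouring : ∀ {n} (G : Graph n) (m : ℕ) → (∀ x y → Dec (Adj G x y)) →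
  ¬ Colourable G ⊤ (suc m) → (∀ w → Colourable G (remove G w ⊤) (suc m)) →
  (∀ x y → Adj G x y → Colourable G (remove G y (remove G x ⊤)) m) → ¬ Complete G →
  ∀ {S A B} → A ∪ B ≡ S → Independent G A → Clique G B →
  ∀ {u v} → u ∈ ∁ S → v ∈ ∁ S → ¬ Reach G (∁ S) u v →
  (∀ z → Dec (Reach G (∁ S) u z)) → Colourable G ⊤ (suc m)
split-separator-colouring {n} G m adj? not-colourable critical double-critical not-complete
  {S} {A} {B} partition independent clique {u} {v} u∉S v∉S u↛v reach? =
  extend-by-independent-set G A independent Glue.glued Glue.glued-proper
  where
    open USide G partition u reach?

    v-off : ¬ USide v
    v-off (inj₁ v∈S) = x∈∁p⇒x∉p v∉S v∈S
    v-off (inj₂ u→v) = u↛v u→v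

    outside-B : ∀ w → Σ (Fin n) λ y → Adj G w y × y ∉ B
    outside-B = neighbour-outside-clique G adj? not-colourable critical not-complete clique

    y₁ y₂ : Fin n
    y₁ = proj₁ (outside-B v)
    y₂ = proj₁ (outside-B u)

    v~y₁ : Adj G v y₁
    v~y₁ = proj₁ (proj₂ (outside-B v))
    u~y₂ : Adj G u y₂
    u~y₂ = proj₁ (proj₂ (outside-B u))

    y₁∉B : y₁ ∉ B
    y₁∉B = proj₂ (proj₂ (outside-B v))
    y₂∉B : y₂ ∉ B
    y₂∉B = proj₂ (proj₂ (outside-B u))

    B-avoids : ∀ {z x} → z ∈ B → x ∉ B → z ≢ x
    B-avoids z∈B x∉B refl = x∉B z∈B

    u-side-in-U₁ : ∀ z → USide z → z ∉ A → z ∈ remove G y₁ (remove G v ⊤)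
    u-side-in-U₁ z z-on z∉A = ∈-remove₂ G (uside-avoids z-on z∉A (inj₂ v-off))
      (uside-avoids z-on z∉A (neighbour-off-side v-off v~y₁ y₁∉B))

    off-side-in-U₂ : ∀ z → ¬ USide z → z ∈ remove G y₂ (remove G u ⊤)
    off-side-in-U₂ z z-off = ∈-remove₂ G (off-side-avoids z-off (inj₂ here))
      (off-side-avoids z-off (neighbour-of-u-on-side u~y₂))

    B-in-U₁ : ∀ z → z ∈ B → z ∈ remove G y₁ (remove G v ⊤)
    B-in-U₁ z z∈B = ∈-remove₂ G (B-avoids z∈B (off-S-not-in-B v∉S)) (B-avoids z∈B y₁∉B)

    B-in-U₂ : ∀ z → z ∈ B → z ∈ remove G y₂ (remove G u ⊤)
    B-in-U₂ z z∈B = ∈-remove₂ G (B-avoids z∈B (off-S-not-in-B u∉S)) (B-avoids z∈B y₂∉B)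

    module Glue = Gluing G clique (λ z → z ∉ A) USide uside? leaving-edge-in-B
      (double-critical v y₁ v~y₁) (double-critical u y₂ u~y₂)
      u-side-in-U₁ off-side-in-U₂ B-in-U₁ B-in-U₂

proposition20 : ∀ {n : ℕ} (G : Graph n) (k : ℕ) → 6 ≤ k →
    KChromatic G k → DoubleCritical G k → ¬ Complete G →
    ∀ (S A B : Subset n) → MinimalSeparating G S →
    ¬ (PartitionOf G S A B × Independent G A × Clique G B)
proposition20 G (suc (suc m)) (s≤s (s≤s _)) (_ , not-colourable) (critical , double-critical)
  not-complete S A B ((u , v , u∉S , v∉S , u↛v) , _) ((partition , _) , independent , clique) =
  ¬¬-decidable₂ λ adj? → ¬¬-decidable λ reach? →
    not-colourable (split-separator-colouring G m adj? not-colourable critical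
      double-critical not-complete partition independent clique u∉S v∉S u↛v reach?)
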